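{- If $(X,\vartriangleleft,R,Q)$ is an additive modal frame, then the operation $\Diamond_Q$, defined by $\Diamond_QA=\{x\in X\mid \forall x'\vartriangleleft x\ \exists y'\in Q(x')\ \exists y\vartriangleright y'\colon y\in A\}$, is completely additive on the lattice $\mathfrak{L}(X,\vartriangleleft)$ of $c_\vartriangleleft$-fixpoints.
   Context: A modal frame is a tuple $(X,\vartriangleleft,R,Q)$ with $X$ a nonempty set and $\vartriangleleft,R,Q$ binary relations on $X$ such that for all $x,y,z$: if $xRy$ and $z\vartriangleleft y$, then there is $x'\vartriangleleft x$ such that for all $x''\vartriangleright x'$ there is $y''$ with $x''Ry''$ and $z\vartriangleleft y''$ ($y\vartriangleright z$ means $z\vartriangleleft y$; $Q(x)=\{y\mid xQy\}$). It is additive if for all $x,y,z$: if $xQy$ and $y\vartriangleleft z$, then there is $x'$ with $x\vartriangleleft x'$ such that for all $x''\vartriangleleft x'$ there is $y''$ with $x''Qy''$ and $y''\vartriangleleft z$. The closure operator is $c_\vartriangleleft(A)=\{x\mid \forall y\vartriangleleft x\ \exists z\vartriangleright y: z\in A\}$; its fixpoints form a complete lattice $\mathfrak{L}(X,\vartriangleleft)$ with meet as intersection and join $\bigvee_i A_i=c_\vartriangleleft(\bigcup_i A_i)$; $\Diamond_Q$ maps fixpoints to fixpoints. Completely additive means $\Diamond_Q(\bigvee_iA_i)=\bigvee_i\Diamond_QA_i$ for every family of fixpoints. -}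

module Defs where

open import Level using (Level; suc; _⊔_)
open import Data.Product using (Σ; _×_; _,_; ∃)

-- Relations on a carrier; xRy is written  R x y ;  z ◁ y  is written  T z y .
Rel : ∀ {ℓ} → Set ℓ → Set (suc ℓ)
Rel {ℓ} X = X → X → Set ℓ

Pred : ∀ {ℓ} → Set ℓ → Set (suc ℓ)
Pred {ℓ} X = X → Set ℓ

module _ {ℓ : Level} {X : Set ℓ} where

  _⊆_ : Pred X → Pred X → Set ℓ
  A ⊆ B = ∀ x → A x → B x

  _≐_ : Pred X → Pred X → Set ℓ
  A ≐ B = (A ⊆ B) × (B ⊆ A)

  IsModalFrame : (T R Q : Rel X) → Set ℓ
  IsModalFrame T R Q =
    ∀ x y z → R x y → T z y →
      Σ X λ x' → T x' x × (∀ x'' → T x' x'' → Σ X λ y'' → R x'' y'' × T z y'')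

  IsAdditive : (T Q : Rel X) → Set ℓ
  IsAdditive T Q =
    ∀ x y z → Q x y → T y z →
      Σ X λ x' → T x x' × (∀ x'' → T x'' x' → Σ X λ y'' → Q x'' y'' × T y'' z)

  closure : Rel X → Pred X → Pred X
  closure T A x = ∀ y → T y x → Σ X λ z → T y z × A z

  IsFixpoint : Rel X → Pred X → Set ℓ
  IsFixpoint T A = closure T A ≐ A

  join : Rel X → {I : Set ℓ} → (I → Pred X) → Pred X
  join T {I} A = closure T (λ x → Σ I λ i → A i x)

  diamond : Rel X → Rel X → Pred X → Pred X
  diamond T Q A x =
    ∀ x' → T x' x → Σ X λ y' → Q x' y' × Σ X λ y → T y' y × A y

  CompletelyAdditive : Rel X → Rel X → Set (suc ℓ)
  CompletelyAdditive T Q =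
    (I : Set ℓ) (A : I → Pred X) → (∀ i → IsFixpoint T (A i)) →
      diamond T Q (join T A) ≐ join T (λ i → diamond T Q (A i))

{-# OPTIONS --safe #-}
module Submission where

open import Defs
open import Level using (Level)
open import Data.Product using (Σ; _×_; _,_)

-- The inclusion ⋁ᵢ ◇Aᵢ ⊆ ◇(⋁ᵢ Aᵢ) holds for every Q: each Aᵢ lies below the
-- join, ◇ is monotone, and ◇B is always closed under c◁, so it contains the
-- least closed set above all ◇Aᵢ. The converse is where additivity enters:
-- a Q-step y Q y' followed by y' ◁ z with z ∈ Aᵢ is lifted to some x' ▷ y
-- with x' ∈ ◇Aᵢ, which places x in c◁(⋃ᵢ ◇Aᵢ).

module _ {ℓ : Level} {X : Set ℓ} (T : Rel X) where

  closure-mono : {A B : Pred X} → A ⊆ B → closure T A ⊆ closure T B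
  closure-mono A⊆B x xA y y◁x with xA y y◁x
  ... | z , y◁z , zA = z , y◁z , A⊆B z zA

  fixpoint⊆join : {I : Set ℓ} {A : I → Pred X} (i : I) →
    IsFixpoint T (A i) → A i ⊆ join T A
  fixpoint⊆join i (_ , A⊆cA) x xA = closure-mono (λ y yA → i , yA) x (A⊆cA x xA)

  join-least : {I : Set ℓ} {A : I → Pred X} {B : Pred X} →
    (∀ i → A i ⊆ B) → closure T B ⊆ B → join T A ⊆ B
  join-least Aᵢ⊆B cB⊆B x xJ = cB⊆B x (closure-mono (λ { y (i , yA) → Aᵢ⊆B i y yA }) x xJ)

  module _ (Q : Rel X) where

    diamond-mono : {A B : Pred X} → A ⊆ B → diamond T Q A ⊆ diamond T Q B
    diamond-mono A⊆B x xA x' x'◁x with xA x' x'◁x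
    ... | y' , x'Qy' , y , y'◁y , yA = y' , x'Qy' , y , y'◁y , A⊆B y yA

    closure-diamond⊆diamond : {A : Pred X} → closure T (diamond T Q A) ⊆ diamond T Q A
    closure-diamond⊆diamond x xcA x' x'◁x with xcA x' x'◁x
    ... | z , x'◁z , z◇A = z◇A x' x'◁z

    join-diamond⊆diamond-join : {I : Set ℓ} {A : I → Pred X} →
      (∀ i → IsFixpoint T (A i)) →
      join T (λ i → diamond T Q (A i)) ⊆ diamond T Q (join T A)
    join-diamond⊆diamond-join fix =
      join-least (λ i → diamond-mono (fixpoint⊆join i (fix i))) closure-diamond⊆diamond

    additive⇒◁-diamond : IsAdditive T Q → {A : Pred X} {y y' z : X} →
      Q y y' → T y' z → A z → Σ X λ x' → T y x' × diamond T Q A x'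
    additive⇒◁-diamond add {y = y} {y'} {z} yQy' y'◁z zA with add y y' z yQy' y'◁z
    ... | x' , y◁x' , lift = x' , y◁x' , λ x'' x''◁x' →
      let (y'' , x''Qy'' , y''◁z) = lift x'' x''◁x' in y'' , x''Qy'' , z , y''◁z , zA

    diamond-join⊆join-diamond : IsAdditive T Q → {I : Set ℓ} {A : I → Pred X} →
      diamond T Q (join T A) ⊆ join T (λ i → diamond T Q (A i))
    diamond-join⊆join-diamond add x x◇J y y◁x with x◇J y y◁x
    ... | y' , yQy' , w , y'◁w , wJ with wJ y' y'◁w
    ... | z , y'◁z , (i , zA) with additive⇒◁-diamond add yQy' y'◁z zA
    ... | x' , y◁x' , x'◇A = x' , y◁x' , i , x'◇A

proposition3p6 : {ℓ : Level} (X : Set ℓ) (x₀ : X) (T R Q : Rel X) →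
    IsModalFrame T R Q → IsAdditive T Q → CompletelyAdditive T Q
proposition3p6 X x₀ T R Q _ add I A fix =
  diamond-join⊆join-diamond T Q add , join-diamond⊆diamond-join T Q fix
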